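{- Let $h\colon\mathbb{Z}^2\to\mathbb{Z}$ be a height function, let $(n_0,i_0,j_0)\in\mathbb{Z}^3$ with $n_0\equiv i_0+j_0 \pmod 2$ and $n_0>h(i_0,j_0)$, and put $p(i,j)=n_0-|i-i_0|-|j-j_0|$. Suppose $(i,j)\in\mathbb{Z}^2$ satisfies $h(i,j)<p(i,j)$, and let $(i',j')\in\mathbb{Z}^2$ be such that $i'$ lies between $i$ and $i_0$ and $j'$ lies between $j$ and $j_0$ (inclusive). Then $h(i',j')<p(i',j')$.
   Context: A height function is a map $h\colon\mathbb{Z}^2\to\mathbb{Z}$ such that $|h(i_1,j_1)-h(i_2,j_2)|=1$ whenever $|i_1-i_2|+|j_1-j_2|=1$, $h(i,j)\equiv i+j\pmod 2$ for all $(i,j)$, and $h(i,j)+|i|+|j|\to\infty$ as $|i|+|j|\to\infty$. (In the paper's language, the faces $(i,j)$ with $h(i,j)<p(i,j)$ are the closed faces of the graph $G_{(n_0,i_0,j_0)}$.) -}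

module Defs where

open import Data.Integer using (ℤ; +_; _+_; _-_; _≤_; _<_; ∣_∣; _⊓_; _⊔_)
open import Data.Integer.Divisibility using (_∣_)
open import Data.Nat using (ℕ)
import Data.Nat as ℕ
open import Data.Product using (_×_; ∃-syntax)
open import Relation.Binary.PropositionalEquality using (_≡_)

abs : ℤ → ℤ
abs x = + ∣ x ∣

_≡₂_ : ℤ → ℤ → Set
a ≡₂ b = (+ 2) ∣ (a - b)

Adjacent : ℤ → ℤ → ℤ → ℤ → Set
Adjacent i₁ j₁ i₂ j₂ = abs (i₁ - i₂) + abs (j₁ - j₂) ≡ + 1

record IsHeightFunction (h : ℤ → ℤ → ℤ) : Set where
  field
    lipschitz : ∀ i₁ j₁ i₂ j₂ → Adjacent i₁ j₁ i₂ j₂ →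
                abs (h i₁ j₁ - h i₂ j₂) ≡ + 1
    parity    : ∀ i j → h i j ≡₂ (i + j)
    growth    : ∀ (M : ℤ) → ∃[ R ] (∀ i j → R < abs i + abs j →
                M < h i j + abs i + abs j)

pyramid : ℤ → ℤ → ℤ → ℤ → ℤ → ℤ
pyramid n₀ i₀ j₀ i j = n₀ - abs (i - i₀) - abs (j - j₀)

Between : ℤ → ℤ → ℤ → Set
Between a b x = (a ⊓ b) ≤ x × x ≤ (a ⊔ b)

-- A height function changes by exactly 1 between adjacent faces, so along each
-- axis it is 1-Lipschitz, and h(i′,j′) ≤ h(i,j) + |i − i′| + |j − j′|.  When i′ lies
-- between i and i₀ (and j′ between j and j₀), the pyramid p grows by exactly
-- |i − i′| + |j − j′| from (i,j) to (i′,j′), so the strict inequality h < p is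
-- carried from (i,j) over to (i′,j′).
module Submission where

open import Defs
open import Data.Integer using (ℤ; _+_; _<_)
open import Data.Integer.Base using (+_; -[1+_]; +[1+_]; -≤+; +≤+; _-_; _≤_; 0ℤ; 1ℤ)
  renaming (suc to sucℤ)
open import Data.Integer.Properties
open import Data.Integer.Tactic.RingSolver using (solve-∀)
open import Data.Nat.Base using (zero; z≤n)
open import Data.Product.Base using (_,_)
open import Data.Sum.Base using (inj₁; inj₂)
open import Relation.Binary.PropositionalEquality

i≤abs[i] : ∀ i → i ≤ abs i
i≤abs[i] (+ n)    = ≤-refl
i≤abs[i] -[1+ n ] = -≤+

abs[i-j]≡abs[j-i] : ∀ i j → abs (i - j) ≡ abs (j - i)
abs[i-j]≡abs[j-i] i j = cong +_ (∣i-j∣≡∣j-i∣ i j)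

i-j+j≡i : ∀ i j → i - j + j ≡ i
i-j+j≡i = solve-∀

i+suc[j]≡suc[i+j] : ∀ i j → i + sucℤ j ≡ sucℤ (i + j)
i+suc[j]≡suc[i+j] i j = begin
  i + (1ℤ + j)  ≡⟨ +-assoc i 1ℤ j ⟨
  i + 1ℤ + j    ≡⟨ cong (_+ j) (+-comm i 1ℤ) ⟩
  1ℤ + i + j    ≡⟨ +-assoc 1ℤ i j ⟩
  1ℤ + (i + j)  ∎
  where open ≡-Reasoning

abs[i-j]≤1⇒i≤suc[j] : ∀ i j → abs (i - j) ≤ 1ℤ → i ≤ sucℤ j
abs[i-j]≤1⇒i≤suc[j] i j abs≤1 = begin
  i               ≡⟨ i-j+j≡i i j ⟨
  i - j + j       ≤⟨ +-monoˡ-≤ j (i≤abs[i] (i - j)) ⟩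
  abs (i - j) + j ≤⟨ +-monoˡ-≤ j abs≤1 ⟩
  1ℤ + j          ∎
  where open ≤-Reasoning

module UnitSteps (f : ℤ → ℤ) (step : ∀ x → abs (f (sucℤ x) - f x) ≤ 1ℤ) where
  open ≤-Reasoning

  private
    up : ∀ x → f (sucℤ x) ≤ sucℤ (f x)
    up x = abs[i-j]≤1⇒i≤suc[j] (f (sucℤ x)) (f x) (step x)

    down : ∀ x → f x ≤ sucℤ (f (sucℤ x))
    down x = abs[i-j]≤1⇒i≤suc[j] (f x) (f (sucℤ x))
      (subst (_≤ 1ℤ) (abs[i-j]≡abs[j-i] (f (sucℤ x)) (f x)) (step x))

  shift-up : ∀ d → 0ℤ ≤ d → ∀ x → f (d + x) ≤ d + f x
  shift-up (+ zero) _ x =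
    ≤-reflexive (trans (cong f (+-identityˡ x)) (sym (+-identityˡ (f x))))
  shift-up +[1+ k ] _ x = begin
    f (+[1+ k ] + x)       ≡⟨ cong f (suc-+ k x) ⟩
    f (sucℤ (+ k + x))     ≤⟨ up (+ k + x) ⟩
    sucℤ (f (+ k + x))     ≤⟨ suc-mono (shift-up (+ k) (+≤+ z≤n) x) ⟩
    sucℤ (+ k + f x)       ≡⟨ suc-+ k (f x) ⟨
    +[1+ k ] + f x         ∎

  shift-down : ∀ d → 0ℤ ≤ d → ∀ x → f x ≤ d + f (d + x)
  shift-down (+ zero) _ x =
    ≤-reflexive (trans (sym (+-identityˡ (f x))) (cong (λ z → 0ℤ + f z) (sym (+-identityˡ x))))
  shift-down +[1+ k ] _ x = begin
    f x                               ≤⟨ down x ⟩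
    sucℤ (f (sucℤ x))                 ≤⟨ suc-mono (shift-down (+ k) (+≤+ z≤n) (sucℤ x)) ⟩
    sucℤ (+ k + f (+ k + sucℤ x))     ≡⟨ suc-+ k (f (+ k + sucℤ x)) ⟨
    +[1+ k ] + f (+ k + sucℤ x)       ≡⟨ cong (λ z → +[1+ k ] + f z) k+suc[x]≡[1+k]+x ⟩
    +[1+ k ] + f (+[1+ k ] + x)       ∎
    where
    k+suc[x]≡[1+k]+x : + k + sucℤ x ≡ +[1+ k ] + x
    k+suc[x]≡[1+k]+x = trans (i+suc[j]≡suc[i+j] (+ k) x) (sym (suc-+ k x))

  1-lipschitz : ∀ x y → f y ≤ f x + abs (x - y)
  1-lipschitz x y with ≤-total x y
  ... | inj₁ x≤y = begin
    f y                  ≡⟨ cong f (i-j+j≡i y x) ⟨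
    f (y - x + x)        ≤⟨ shift-up (y - x) (i≤j⇒0≤j-i x≤y) x ⟩
    y - x + f x          ≡⟨ +-comm (y - x) (f x) ⟩
    f x + (y - x)        ≡⟨ cong (λ z → f x + z) (∣-∣-≤ x≤y) ⟨
    f x + abs (x - y)    ∎
  ... | inj₂ y≤x = begin
    f y                  ≤⟨ shift-down (x - y) (i≤j⇒0≤j-i y≤x) y ⟩
    x - y + f (x - y + y) ≡⟨ cong (λ z → x - y + f z) (i-j+j≡i x y) ⟩
    x - y + f x          ≡⟨ +-comm (x - y) (f x) ⟩
    f x + (x - y)        ≡⟨ cong (λ z → f x + z) (trans (abs[i-j]≡abs[j-i] x y) (∣-∣-≤ y≤x)) ⟨
    f x + abs (x - y)    ∎

open UnitSteps using (1-lipschitz)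

abs-additive : ∀ {a c} y → a ≤ y → y ≤ c → abs (a - c) ≡ abs (a - y) + abs (y - c)
abs-additive {a} {c} y a≤y y≤c = begin
  abs (a - c)              ≡⟨ ∣-∣-≤ (≤-trans a≤y y≤c) ⟩
  c - a                    ≡⟨ +-minus-telescope c y a ⟨
  (c - y) + (y - a)        ≡⟨ +-comm (c - y) (y - a) ⟩
  (y - a) + (c - y)        ≡⟨ cong₂ _+_ (∣-∣-≤ a≤y) (∣-∣-≤ y≤c) ⟨
  abs (a - y) + abs (y - c) ∎
  where open ≡-Reasoning

Between⇒abs-additive : ∀ {a c y} → Between a c y → abs (a - c) ≡ abs (a - y) + abs (y - c)
Between⇒abs-additive {a} {c} {y} (a⊓c≤y , y≤a⊔c) with ≤-total a c
... | inj₁ a≤c = abs-additive y (subst (_≤ y) (i≤j⇒i⊓j≡i a≤c) a⊓c≤y)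
                                (subst (y ≤_) (i≤j⇒i⊔j≡j a≤c) y≤a⊔c)
... | inj₂ c≤a = begin
  abs (a - c)               ≡⟨ abs[i-j]≡abs[j-i] a c ⟩
  abs (c - a)               ≡⟨ abs-additive y (subst (_≤ y) (i≥j⇒i⊓j≡j c≤a) a⊓c≤y)
                                              (subst (y ≤_) (i≥j⇒i⊔j≡i c≤a) y≤a⊔c) ⟩
  abs (c - y) + abs (y - a) ≡⟨ cong₂ _+_ (abs[i-j]≡abs[j-i] c y) (abs[i-j]≡abs[j-i] y a) ⟩
  abs (y - c) + abs (a - y) ≡⟨ +-comm (abs (y - c)) (abs (a - y)) ⟩
  abs (a - y) + abs (y - c) ∎
  where open ≡-Reasoning

1+i-i≡1 : ∀ i → 1ℤ + i - i ≡ 1ℤ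
1+i-i≡1 = solve-∀

horizontal-neighbours : ∀ x y → Adjacent (sucℤ x) y x y
horizontal-neighbours x y = cong₂ (λ u v → abs u + abs v) (1+i-i≡1 x) (+-inverseʳ y)

vertical-neighbours : ∀ x y → Adjacent x (sucℤ y) x y
vertical-neighbours x y = cong₂ (λ u v → abs u + abs v) (+-inverseʳ x) (1+i-i≡1 y)

height-lipschitz : ∀ {h} → IsHeightFunction h →
                   ∀ i j i′ j′ → h i′ j′ ≤ h i j + abs (i - i′) + abs (j - j′)
height-lipschitz {h} isHeight i j i′ j′ = begin
  h i′ j′                              ≤⟨ 1-lipschitz (h i′) (column-step i′) j j′ ⟩
  h i′ j + abs (j - j′)                ≤⟨ +-monoˡ-≤ (abs (j - j′)) (1-lipschitz (λ x → h x j) (row-step j) i i′) ⟩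
  h i j + abs (i - i′) + abs (j - j′)  ∎
  where
  open ≤-Reasoning
  open IsHeightFunction isHeight using (lipschitz)

  row-step : ∀ y x → abs (h (sucℤ x) y - h x y) ≤ 1ℤ
  row-step y x = ≤-reflexive (lipschitz _ _ _ _ (horizontal-neighbours x y))

  column-step : ∀ x y → abs (h x (sucℤ y) - h x y) ≤ 1ℤ
  column-step x y = ≤-reflexive (lipschitz _ _ _ _ (vertical-neighbours x y))

pyramid-between : ∀ n₀ i₀ j₀ {i j i′ j′} → Between i i₀ i′ → Between j j₀ j′ →
                  pyramid n₀ i₀ j₀ i j + abs (i - i′) + abs (j - j′) ≡ pyramid n₀ i₀ j₀ i′ j′
pyramid-between n₀ i₀ j₀ {i} {j} {i′} {j′} i′-between j′-between = begin
  n₀ - abs (i - i₀) - abs (j - j₀) + abs (i - i′) + abs (j - j′)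
    ≡⟨ cong₂ (λ u v → n₀ - u - v + abs (i - i′) + abs (j - j′))
             (Between⇒abs-additive i′-between) (Between⇒abs-additive j′-between) ⟩
  n₀ - (abs (i - i′) + abs (i′ - i₀)) - (abs (j - j′) + abs (j′ - j₀)) + abs (i - i′) + abs (j - j′)
    ≡⟨ cancel n₀ (abs (i - i′)) (abs (i′ - i₀)) (abs (j - j′)) (abs (j′ - j₀)) ⟩
  n₀ - abs (i′ - i₀) - abs (j′ - j₀) ∎
  where
  open ≡-Reasoning
  cancel : ∀ n a a′ b b′ → n - (a + a′) - (b + b′) + a + b ≡ n - a′ - b′
  cancel = solve-∀

mainTheorem4 : (h : ℤ → ℤ → ℤ) → IsHeightFunction h →
    (n₀ i₀ j₀ : ℤ) → n₀ ≡₂ (i₀ + j₀) → h i₀ j₀ < n₀ →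
    (i j : ℤ) → h i j < pyramid n₀ i₀ j₀ i j →
    (i′ j′ : ℤ) → Between i i₀ i′ → Between j j₀ j′ →
    h i′ j′ < pyramid n₀ i₀ j₀ i′ j′
mainTheorem4 h isHeight n₀ i₀ j₀ _ _ i j h<p i′ j′ i′-between j′-between = begin-strict
  h i′ j′                                             ≤⟨ height-lipschitz isHeight i j i′ j′ ⟩
  h i j + abs (i - i′) + abs (j - j′)                 <⟨ +-monoˡ-< (abs (j - j′)) (+-monoˡ-< (abs (i - i′)) h<p) ⟩
  pyramid n₀ i₀ j₀ i j + abs (i - i′) + abs (j - j′)  ≡⟨ pyramid-between n₀ i₀ j₀ i′-between j′-between ⟩
  pyramid n₀ i₀ j₀ i′ j′                              ∎
  where open ≤-Reasoning
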